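{- Let $P$ be a building block polygon whose lattice points correspond to characters $\chi_0,\dots,\chi_n$ of $T=(\mathbb C^*)^2$. Let $X\subseteq\mathbb P^n$ be the projective toric surface given as the closure of the image of $p\mapsto[\chi_0(p):\dots:\chi_n(p)]$. Then there is no line $\ell\subseteq\mathbb P^n$ contained in $X$ that passes through the identity point $[1:\dots:1]$ of $T\subseteq X$.
   Context: - A polygon means a convex polygon in $\mathbb R^2$ with vertices in $\mathbb Z^2$. - A building block polygon is a polygon with exactly one interior lattice point and at most five lattice points. - The lattice point $(a,b)$ corresponds to the character $x^ay^b$. -}

module Defs where

open import Level using (Level; _⊔_) renaming (suc to lsuc)
open import Data.Nat using (ℕ; zero; suc; _≤_; _<_)
open import Data.Integer using (ℤ; +_; -[1+_]) renaming (_+_ to _+ℤ_; _*_ to _*ℤ_)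
open import Data.Product using (Σ; ∃; _×_; _,_)
open import Data.Fin using (Fin)
open import Data.Vec using (Vec; []; _∷_; lookup; map; tabulate)
open import Data.List using (List; []; _∷_; _++_; [_])
open import Relation.Binary.PropositionalEquality using (_≡_)
open import Relation.Nullary using (¬_)
open import Algebra.Bundles using (CommutativeRing)

Pt : Set
Pt = ℤ × ℤ

_⊕_ : Pt → Pt → Pt
(a , b) ⊕ (c , d) = (a +ℤ c , b +ℤ d)

_·_ : ℕ → Pt → Pt
m · (a , b) = ((+ m) *ℤ a , (+ m) *ℤ b)

sumℕ : ∀ {k} → Vec ℕ k → ℕ
sumℕ [] = 0
sumℕ (x ∷ xs) = x Data.Nat.+ sumℕ xs

wsum : ∀ {k} → Vec ℕ k → Vec Pt k → Pt
wsum [] [] = (+ 0 , + 0)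
wsum (w ∷ ws) (p ∷ ps) = (w · p) ⊕ wsum ws ps

-- The rational point num/den (den > 0) lies in the convex hull of the
-- points of L: it is a convex combination of them with rational weights
-- w_i / N (denominators cleared: N = Σ w_i > 0, den·Σ w_i p_i = N·num).
InConv : ∀ {k} → Vec Pt k → Pt → ℕ → Set
InConv L num den =
  Σ (Vec ℕ _) λ w → (0 < sumℕ w) × (den · wsum w L ≡ sumℕ w · num)

-- q lies in the topological interior of conv(L): for some M > 0 the four
-- points q ± (1/M) e₁, q ± (1/M) e₂ lie in conv(L).
IsInterior : ∀ {k} → Vec Pt k → Pt → Set
IsInterior L q = Σ ℕ λ m →
    InConv L ((suc m · q) ⊕ (+ 1 , + 0)) (suc m)
  × InConv L ((suc m · q) ⊕ (-[1+ 0 ] , + 0)) (suc m)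
  × InConv L ((suc m · q) ⊕ (+ 0 , + 1)) (suc m)
  × InConv L ((suc m · q) ⊕ (+ 0 , -[1+ 0 ])) (suc m)

-- L lists (without repetition) exactly the lattice points of conv(L).
IsLatticePolygonPoints : ∀ {k} → Vec Pt k → Set
IsLatticePolygonPoints L =
    (∀ i j → lookup L i ≡ lookup L j → i ≡ j)
  × (∀ q → InConv L q 1 → Σ (Fin _) λ i → lookup L i ≡ q)

-- L = list of all lattice points of a building block polygon
-- (exactly one interior lattice point, at most five lattice points).
BuildingBlock : ∀ {n} → Vec Pt (suc n) → Set
BuildingBlock {n} L =
    IsLatticePolygonPoints L
  × (Σ Pt λ q → IsInterior L q × (∀ q' → IsInterior L q' → q' ≡ q))
  × (suc n ≤ 5)

-- Algebraically closed fields of characteristic zero (stand-in for ℂ)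

module _ {c ℓ} (R : CommutativeRing c ℓ) where
  open CommutativeRing R
  peval : List Carrier → Carrier → Carrier
  peval [] x = 0#
  peval (a ∷ as) x = a + x * peval as x
  natK : ℕ → Carrier
  natK zero = 0#
  natK (suc m) = 1# + natK m

record ACF0 (c ℓ : Level) : Set (lsuc (c ⊔ ℓ)) where
  field
    cring : CommutativeRing c ℓ
  open CommutativeRing cring public
  field
    1≉0 : ¬ (1# ≈ 0#)
    inverse : ∀ x → ¬ (x ≈ 0#) → Σ Carrier λ y → x * y ≈ 1#
    char0 : ∀ m → ¬ (natK cring (suc m) ≈ 0#)
    -- every monic polynomial of degree ≥ 1 has a root
    algClosed : ∀ (a : Carrier) (as : List Carrier) →
                Σ Carrier λ x → peval cring ((a ∷ as) ++ [ 1# ]) x ≈ 0#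

module Toric {c ℓ} (K : ACF0 c ℓ) where
  open ACF0 K

  pow : Carrier → ℕ → Carrier
  pow x zero = 1#
  pow x (suc m) = x * pow x m

  -- s^a where s' = s⁻¹
  powℤ : Carrier → Carrier → ℤ → Carrier
  powℤ s s' (+ m) = pow s m
  powℤ s s' -[1+ m ] = pow s' (suc m)

  -- the character χ_(a,b)(s,t) = s^a t^b, at the torus point (s,t)
  -- represented as (s, s⁻¹, t, t⁻¹)
  character : Pt → Carrier → Carrier → Carrier → Carrier → Carrier
  character (a , b) s s' t t' = powℤ s s' a * powℤ t t' b

  Poly : ℕ → Set c
  Poly N = List (Carrier × Vec ℕ N)

  monomial : ∀ {N} → Vec ℕ N → Vec Carrier N → Carrier
  monomial [] [] = 1#
  monomial (e ∷ es) (x ∷ xs) = pow x e * monomial es xs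

  evalPoly : ∀ {N} → Poly N → Vec Carrier N → Carrier
  evalPoly [] q = 0#
  evalPoly ((a , e) ∷ f) q = a * monomial e q + evalPoly f q

  -- q ∈ K^(n+1) lies in the affine cone over X, i.e. in the Zariski
  -- closure of { λ·(χ₀(p),…,χₙ(p)) : λ ∈ K, p ∈ T }.
  InCone : ∀ {N} → Vec Pt N → Vec Carrier N → Set (c ⊔ ℓ)
  InCone L q = ∀ (f : Poly _) →
    (∀ lam s s' t t' → s * s' ≈ 1# → t * t' ≈ 1# →
       evalPoly f (map (λ χ → lam * character χ s s' t t') L) ≈ 0#) →
    evalPoly f q ≈ 0#

  -- There is a line in ℙⁿ through [1:…:1] contained in X: it is spanned by
  -- (1,…,1) and some v not proportional to it, and every point [a·1 + b·v]
  -- with (a,b) ≠ (0,0) lies on X.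
  LineThroughIdentityOnX : ∀ {N} → Vec Pt N → Set (c ⊔ ℓ)
  LineThroughIdentityOnX {N} L =
    Σ (Vec Carrier N) λ v →
        ¬ (Σ Carrier λ k → ∀ i → lookup v i ≈ k)
      × (∀ a b → ¬ ((a ≈ 0#) × (b ≈ 0#)) →
           InCone L (tabulate (λ i → a + b * lookup v i)))

module Submission where

-- Let q be the interior lattice point of the polygon P = conv(L). The proof
-- only uses that q exists, and runs in two parts.
--
-- Since q is interior, the
-- vectors L_i − q span the whole plane as a rational cone; hence for every
-- index j there are weights W ∈ ℕ^L with W_j > 0 and Σ W_i L_i = (Σ W_i) q,
-- i.e. q is a convex combination of the lattice points of P giving any
-- prescribed one positive weight.  In particular q = L_k for some k.
--
-- Such weights give the toric relation
-- x^W = x_k^{ΣW} on the affine cone over X.  So a point of the cone whose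
-- j-th coordinate vanishes has vanishing k-th coordinate.  A line through
-- [1:…:1] spanned by 1 and v contains the point v − v_j·1, whose j-th
-- coordinate is 0; hence v_k = v_j for every j, so v is constant (up to the
-- double negations forced by the constructive field), a contradiction.

open import Defs
open import Data.Nat using (ℕ; suc)
open import Data.Vec using (Vec)
open import Relation.Nullary using (¬_)

open import Data.Nat as ℕ using (zero; _<_; s≤s; z≤n)
import Data.Nat.Properties as ℕP
open import Data.Integer as ℤ using (ℤ; +_; -[1+_]; _⊖_)
import Data.Integer.Properties as ℤP
open import Data.Integer.Tactic.RingSolver using (solve-∀)
open import Data.Fin using (Fin; zero; suc)
open import Data.Vec using ([]; _∷_; lookup; map; zipWith; replicate; tabulate)
import Data.Vec.Properties as VecP
open import Data.List using ([]; _∷_)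
open import Data.Product using (Σ; _×_; _,_; proj₁; proj₂)
open import Relation.Binary.PropositionalEquality as ≡ using (_≡_)

module LatticeGeometry where
  open ≡
  open ≡-Reasoning
  open import Algebra.Bundles using (AbelianGroup)
  open import Algebra.Properties.CommutativeSemigroup ℤP.+-commutativeSemigroup using (interchange)
  open import Algebra.Properties.Group (AbelianGroup.group ℤP.+-0-abelianGroup)
    using () renaming (∙-cancelʳ to +-cancelʳ)

  O : Pt
  O = (+ 0 , + 0)

  neg : Pt → Pt
  neg (a , b) = (ℤ.- a , ℤ.- b)

  ⊕-comm : ∀ p q → p ⊕ q ≡ q ⊕ p
  ⊕-comm (a , b) (c , d) = cong₂ _,_ (ℤP.+-comm a c) (ℤP.+-comm b d)

  ⊕-identityˡ : ∀ p → O ⊕ p ≡ p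
  ⊕-identityˡ (a , b) = cong₂ _,_ (ℤP.+-identityˡ a) (ℤP.+-identityˡ b)

  ⊕-inverseʳ : ∀ p → p ⊕ neg p ≡ O
  ⊕-inverseʳ (a , b) = cong₂ _,_ (ℤP.+-inverseʳ a) (ℤP.+-inverseʳ b)

  ⊕-interchange : ∀ p q r s → (p ⊕ q) ⊕ (r ⊕ s) ≡ (p ⊕ r) ⊕ (q ⊕ s)
  ⊕-interchange (a , a') (b , b') (c , c') (d , d') =
    cong₂ _,_ (interchange a b c d) (interchange a' b' c' d')

  ⊕-cancelʳ : ∀ p q r → p ⊕ r ≡ q ⊕ r → p ≡ q
  ⊕-cancelʳ (a , a') (b , b') (c , c') eq =
    cong₂ _,_ (+-cancelʳ c a b (cong proj₁ eq)) (+-cancelʳ c' a' b' (cong proj₂ eq))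

  ⊕-neg-cancel : ∀ p q → (p ⊕ neg q) ⊕ q ≡ p
  ⊕-neg-cancel (a , a') (b , b') = cong₂ _,_ (shift a b) (shift a' b')
    where
    shift : ∀ (x y : ℤ) → (x ℤ.+ ℤ.- y) ℤ.+ y ≡ x
    shift = solve-∀

  ·-identityˡ : ∀ p → 1 · p ≡ p
  ·-identityˡ (a , b) = cong₂ _,_ (ℤP.*-identityˡ a) (ℤP.*-identityˡ b)

  ·-zeroʳ : ∀ c → c · O ≡ O
  ·-zeroʳ c = cong₂ _,_ (ℤP.*-zeroʳ (+ c)) (ℤP.*-zeroʳ (+ c))

  ·-distribʳ-+ : ∀ a b p → (a ℕ.+ b) · p ≡ (a · p) ⊕ (b · p)
  ·-distribʳ-+ a b (x , y) = cong₂ _,_ (distrib x) (distrib y)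
    where
    distrib : ∀ x → + (a ℕ.+ b) ℤ.* x ≡ + a ℤ.* x ℤ.+ + b ℤ.* x
    distrib x = trans (cong (ℤ._* x) (ℤP.pos-+ a b)) (ℤP.*-distribʳ-+ x (+ a) (+ b))

  ·-distribˡ-⊕ : ∀ c p q → c · (p ⊕ q) ≡ (c · p) ⊕ (c · q)
  ·-distribˡ-⊕ c (x , y) (x' , y') =
    cong₂ _,_ (ℤP.*-distribˡ-+ (+ c) x x') (ℤP.*-distribˡ-+ (+ c) y y')

  ·-assoc : ∀ a b p → (a ℕ.* b) · p ≡ a · (b · p)
  ·-assoc a b (x , y) = cong₂ _,_ (assoc x) (assoc y)
    where
    assoc : ∀ x → + (a ℕ.* b) ℤ.* x ≡ + a ℤ.* (+ b ℤ.* x)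
    assoc x = trans (cong (ℤ._* x) (ℤP.pos-* a b)) (ℤP.*-assoc (+ a) (+ b) x)

  ·-comm : ∀ a b p → a · (b · p) ≡ b · (a · p)
  ·-comm a b p = begin
    a · (b · p)    ≡⟨ ·-assoc a b p ⟨
    (a ℕ.* b) · p  ≡⟨ cong (_· p) (ℕP.*-comm a b) ⟩
    (b ℕ.* a) · p  ≡⟨ ·-assoc b a p ⟩
    b · (a · p)    ∎

  infixl 6 _+ᵥ_
  infixr 7 _*ᵥ_

  _+ᵥ_ : ∀ {k} → Vec ℕ k → Vec ℕ k → Vec ℕ k
  _+ᵥ_ = zipWith ℕ._+_

  _*ᵥ_ : ∀ {k} → ℕ → Vec ℕ k → Vec ℕ k
  c *ᵥ u = map (c ℕ.*_) u

  single : ∀ {k} → Fin k → ℕ → Vec ℕ k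
  single zero c = c ∷ replicate _ 0
  single (suc i) c = 0 ∷ single i c

  wsum-+ᵥ : ∀ {k} (u w : Vec ℕ k) L → wsum (u +ᵥ w) L ≡ wsum u L ⊕ wsum w L
  wsum-+ᵥ [] [] [] = refl
  wsum-+ᵥ (a ∷ u) (b ∷ w) (p ∷ L) = begin
    ((a ℕ.+ b) · p) ⊕ wsum (u +ᵥ w) L
      ≡⟨ cong₂ _⊕_ (·-distribʳ-+ a b p) (wsum-+ᵥ u w L) ⟩
    ((a · p) ⊕ (b · p)) ⊕ (wsum u L ⊕ wsum w L)
      ≡⟨ ⊕-interchange (a · p) (b · p) (wsum u L) (wsum w L) ⟩
    ((a · p) ⊕ wsum u L) ⊕ ((b · p) ⊕ wsum w L) ∎

  wsum-*ᵥ : ∀ {k} c (u : Vec ℕ k) L → wsum (c *ᵥ u) L ≡ c · wsum u L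
  wsum-*ᵥ c [] [] = sym (·-zeroʳ c)
  wsum-*ᵥ c (a ∷ u) (p ∷ L) = begin
    ((c ℕ.* a) · p) ⊕ wsum (c *ᵥ u) L  ≡⟨ cong₂ _⊕_ (·-assoc c a p) (wsum-*ᵥ c u L) ⟩
    (c · (a · p)) ⊕ (c · wsum u L)     ≡⟨ ·-distribˡ-⊕ c (a · p) (wsum u L) ⟨
    c · ((a · p) ⊕ wsum u L)           ∎

  wsum-zeros : ∀ {k} (L : Vec Pt k) → wsum (replicate k 0) L ≡ O
  wsum-zeros [] = refl
  wsum-zeros (p ∷ L) = trans (cong (O ⊕_) (wsum-zeros L)) (⊕-identityˡ O)

  wsum-single : ∀ {k} (i : Fin k) c L → wsum (single i c) L ≡ c · lookup L i
  wsum-single zero c (p ∷ L) =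
    trans (cong ((c · p) ⊕_) (wsum-zeros L)) (trans (⊕-comm (c · p) O) (⊕-identityˡ (c · p)))
  wsum-single (suc i) c (p ∷ L) = trans (cong (O ⊕_) (wsum-single i c L)) (⊕-identityˡ _)

  sum-single : ∀ {k} (i : Fin k) c → sumℕ (single i c) ≡ c
  sum-single {suc k} zero c = trans (cong (c ℕ.+_) (sum-zeros k)) (ℕP.+-identityʳ c)
    where
    sum-zeros : ∀ k → sumℕ (replicate k 0) ≡ 0
    sum-zeros zero = refl
    sum-zeros (suc k) = sum-zeros k
  sum-single (suc i) c = sum-single i c

  lookup-single : ∀ {k} (i : Fin k) c → lookup (single i c) i ≡ c
  lookup-single zero c = refl
  lookup-single (suc i) c = lookup-single i c

  lookup-pos⇒sum-pos : ∀ {k} (W : Vec ℕ k) j → 0 < lookup W j → 0 < sumℕ W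
  lookup-pos⇒sum-pos (w ∷ W) zero w>0 = ℕP.<-≤-trans w>0 (ℕP.m≤m+n w (sumℕ W))
  lookup-pos⇒sum-pos (w ∷ W) (suc j) p =
    ℕP.<-≤-trans (lookup-pos⇒sum-pos W j p) (ℕP.m≤n+m (sumℕ W) w)

  InRatCone : ∀ {k} → Vec Pt k → Pt → Set
  InRatCone D v = Σ (Vec ℕ _) λ W → Σ ℕ λ N → (0 < N) × (wsum W D ≡ N · v)

  cone-⊕ : ∀ {k} {D : Vec Pt k} {u v} → InRatCone D u → InRatCone D v → InRatCone D (u ⊕ v)
  cone-⊕ {D = D} {u} {v} (W₁ , N₁ , N₁>0 , e₁) (W₂ , N₂ , N₂>0 , e₂) =
    (N₂ *ᵥ W₁) +ᵥ (N₁ *ᵥ W₂) , N₁ ℕ.* N₂ , ℕP.*-mono-< N₁>0 N₂>0 , (begin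
      wsum ((N₂ *ᵥ W₁) +ᵥ (N₁ *ᵥ W₂)) D
        ≡⟨ wsum-+ᵥ (N₂ *ᵥ W₁) (N₁ *ᵥ W₂) D ⟩
      wsum (N₂ *ᵥ W₁) D ⊕ wsum (N₁ *ᵥ W₂) D
        ≡⟨ cong₂ _⊕_ (wsum-*ᵥ N₂ W₁ D) (wsum-*ᵥ N₁ W₂ D) ⟩
      (N₂ · wsum W₁ D) ⊕ (N₁ · wsum W₂ D)
        ≡⟨ cong₂ _⊕_ (cong (N₂ ·_) e₁) (cong (N₁ ·_) e₂) ⟩
      (N₂ · (N₁ · u)) ⊕ (N₁ · (N₂ · v))
        ≡⟨ cong (_⊕ (N₁ · (N₂ · v))) (·-comm N₂ N₁ u) ⟩
      (N₁ · (N₂ · u)) ⊕ (N₁ · (N₂ · v))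
        ≡⟨ ·-distribˡ-⊕ N₁ (N₂ · u) (N₂ · v) ⟨
      N₁ · ((N₂ · u) ⊕ (N₂ · v))
        ≡⟨ cong (N₁ ·_) (·-distribˡ-⊕ N₂ u v) ⟨
      N₁ · (N₂ · (u ⊕ v))
        ≡⟨ ·-assoc N₁ N₂ (u ⊕ v) ⟨
      (N₁ ℕ.* N₂) · (u ⊕ v) ∎)

  cone-· : ∀ {k} {D : Vec Pt k} c {v} → InRatCone D v → InRatCone D (c · v)
  cone-· {D = D} c {v} (W , N , N>0 , e) =
    c *ᵥ W , N , N>0 , trans (wsum-*ᵥ c W D) (trans (cong (c ·_) e) (·-comm c N v))

  cone-whole-plane : ∀ {k} {D : Vec Pt k} →
    InRatCone D (+ 1 , + 0) → InRatCone D (-[1+ 0 ] , + 0) →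
    InRatCone D (+ 0 , + 1) → InRatCone D (+ 0 , -[1+ 0 ]) →
    ∀ v → InRatCone D v
  cone-whole-plane {D = D} e₁ -e₁ e₂ -e₂ (a , b) =
    subst (InRatCone D) (cong₂ _,_ (ℤP.+-identityʳ a) (ℤP.+-identityˡ b))
          (cone-⊕ (horizontal a) (vertical b))
    where
    positive : ∀ n → + n ℤ.* + 1 ≡ + n
    positive n = ℤP.*-identityʳ (+ n)
    negative : ∀ n → + suc n ℤ.* -[1+ 0 ] ≡ -[1+ n ]
    negative n = minus (+ suc n)
      where
      minus : ∀ x → x ℤ.* ℤ.- (+ 1) ≡ ℤ.- x
      minus = solve-∀
    horizontal : ∀ a → InRatCone D (a , + 0)
    horizontal (+ n) = subst (InRatCone D) (cong₂ _,_ (positive n) (ℤP.*-zeroʳ (+ n))) (cone-· n e₁)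
    horizontal -[1+ n ] =
      subst (InRatCone D) (cong₂ _,_ (negative n) (ℤP.*-zeroʳ (+ suc n))) (cone-· (suc n) -e₁)
    vertical : ∀ b → InRatCone D (+ 0 , b)
    vertical (+ n) = subst (InRatCone D) (cong₂ _,_ (ℤP.*-zeroʳ (+ n)) (positive n)) (cone-· n e₂)
    vertical -[1+ n ] =
      subst (InRatCone D) (cong₂ _,_ (ℤP.*-zeroʳ (+ suc n)) (negative n)) (cone-· (suc n) -e₂)

  relative : ∀ {k} → Vec Pt k → Pt → Vec Pt k
  relative L q = map (λ p → p ⊕ neg q) L

  wsum-relative : ∀ {k} (W : Vec ℕ k) L q →
    wsum W (relative L q) ⊕ (sumℕ W · q) ≡ wsum W L
  wsum-relative [] [] q = trans (cong (O ⊕_) (·-zeroʳ 0)) (⊕-identityˡ O)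
  wsum-relative (w ∷ W) (p ∷ L) q = begin
    ((w · (p ⊕ neg q)) ⊕ wsum W (relative L q)) ⊕ ((w ℕ.+ sumℕ W) · q)
      ≡⟨ cong (((w · (p ⊕ neg q)) ⊕ wsum W (relative L q)) ⊕_) (·-distribʳ-+ w (sumℕ W) q) ⟩
    ((w · (p ⊕ neg q)) ⊕ wsum W (relative L q)) ⊕ ((w · q) ⊕ (sumℕ W · q))
      ≡⟨ ⊕-interchange (w · (p ⊕ neg q)) (wsum W (relative L q)) (w · q) (sumℕ W · q) ⟩
    ((w · (p ⊕ neg q)) ⊕ (w · q)) ⊕ (wsum W (relative L q) ⊕ (sumℕ W · q))
      ≡⟨ cong₂ _⊕_ (sym (·-distribˡ-⊕ w (p ⊕ neg q) q)) (wsum-relative W L q) ⟩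
    (w · ((p ⊕ neg q) ⊕ q)) ⊕ wsum W L
      ≡⟨ cong (λ r → (w · r) ⊕ wsum W L) (⊕-neg-cancel p q) ⟩
    (w · p) ⊕ wsum W L ∎

  shifted-point-direction : ∀ {k} (L : Vec Pt k) q m e →
    InConv L ((suc m · q) ⊕ e) (suc m) → InRatCone (relative L q) e
  shifted-point-direction L q m e (w , S>0 , conv) =
    M *ᵥ w , S , S>0 , trans (wsum-*ᵥ M w D) (⊕-cancelʳ (M · wsum w D) (S · e) R (begin
      (M · wsum w D) ⊕ R                ≡⟨ cong ((M · wsum w D) ⊕_) (·-comm S M q) ⟩
      (M · wsum w D) ⊕ (M · (S · q))    ≡⟨ ·-distribˡ-⊕ M (wsum w D) (S · q) ⟨
      M · (wsum w D ⊕ (S · q))          ≡⟨ cong (M ·_) (wsum-relative w L q) ⟩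
      M · wsum w L                      ≡⟨ conv ⟩
      S · ((M · q) ⊕ e)                 ≡⟨ ·-distribˡ-⊕ S (M · q) e ⟩
      R ⊕ (S · e)                       ≡⟨ ⊕-comm R (S · e) ⟩
      (S · e) ⊕ R                       ∎))
    where
    M S : ℕ
    M = suc m
    S = sumℕ w
    D : Vec Pt _
    D = relative L q
    R : Pt
    R = S · (M · q)

  interior-spans-plane : ∀ {k} {L : Vec Pt k} {q} → IsInterior L q → ∀ v → InRatCone (relative L q) v
  interior-spans-plane {L = L} {q} (m , right , left , up , down) =
    cone-whole-plane (shifted-point-direction L q m _ right) (shifted-point-direction L q m _ left)
                     (shifted-point-direction L q m _ up) (shifted-point-direction L q m _ down)

  balancing-weights : ∀ {k} (D : Vec Pt k) → (∀ v → InRatCone D v) →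
    ∀ i → Σ (Vec ℕ k) λ W → (0 < lookup W i) × (wsum W D ≡ O)
  balancing-weights D spans i with spans (neg (lookup D i))
  ... | W , N , N>0 , e = single i N +ᵥ W , positive , balanced
    where
    positive : 0 < lookup (single i N +ᵥ W) i
    positive rewrite VecP.lookup-zipWith ℕ._+_ i (single i N) W | lookup-single i N =
      ℕP.<-≤-trans N>0 (ℕP.m≤m+n N (lookup W i))
    balanced : wsum (single i N +ᵥ W) D ≡ O
    balanced = begin
      wsum (single i N +ᵥ W) D                     ≡⟨ wsum-+ᵥ (single i N) W D ⟩
      wsum (single i N) D ⊕ wsum W D               ≡⟨ cong₂ _⊕_ (wsum-single i N D) e ⟩
      (N · lookup D i) ⊕ (N · neg (lookup D i))    ≡⟨ ·-distribˡ-⊕ N _ _ ⟨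
      N · (lookup D i ⊕ neg (lookup D i))          ≡⟨ cong (N ·_) (⊕-inverseʳ (lookup D i)) ⟩
      N · O                                        ≡⟨ ·-zeroʳ N ⟩
      O                                            ∎

  interior-weights : ∀ {k} {L : Vec Pt k} {q} → IsInterior L q →
    ∀ i → Σ (Vec ℕ k) λ W → (0 < lookup W i) × (wsum W L ≡ sumℕ W · q)
  interior-weights {L = L} {q} interior i =
    recentre (balancing-weights (relative L q) (interior-spans-plane interior) i)
    where
    recentre : Σ (Vec ℕ _) (λ W → (0 < lookup W i) × (wsum W (relative L q) ≡ O)) →
               Σ (Vec ℕ _) (λ W → (0 < lookup W i) × (wsum W L ≡ sumℕ W · q))
    recentre (W , Wᵢ>0 , balanced) = W , Wᵢ>0 , (begin
      wsum W L                              ≡⟨ wsum-relative W L q ⟨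
      wsum W (relative L q) ⊕ (sumℕ W · q)  ≡⟨ cong (_⊕ (sumℕ W · q)) balanced ⟩
      O ⊕ (sumℕ W · q)                      ≡⟨ ⊕-identityˡ (sumℕ W · q) ⟩
      sumℕ W · q                            ∎)

  interior-is-listed : ∀ {n} {L : Vec Pt (suc n)} {q} →
    IsLatticePolygonPoints L → IsInterior L q → Σ (Fin (suc n)) λ k → lookup L k ≡ q
  interior-is-listed {n} {L} {q} (_ , complete) interior = listed (interior-weights interior zero)
    where
    listed : Σ (Vec ℕ (suc n)) (λ W → (0 < lookup W zero) × (wsum W L ≡ sumℕ W · q)) →
             Σ (Fin (suc n)) λ k → lookup L k ≡ q
    listed (W , W₀>0 , barycentre) =
      complete q (W , lookup-pos⇒sum-pos W zero W₀>0 , trans (·-identityˡ (wsum W L)) barycentre)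

open LatticeGeometry

module ToricSurface {c ℓ} (K : ACF0 c ℓ) where
  open ACF0 K
  open Toric K
  open import Algebra.Properties.CommutativeSemiring.Exp commutativeSemiring
    using (_^_; ^-homo-*; ^-distrib-*)
  open import Algebra.Properties.CommutativeSemigroup *-commutativeSemigroup using (interchange)
  open import Algebra.Properties.Ring ring using (-1*x≈-x)
  open import Algebra.Properties.Group +-group using (x∙y⁻¹≈ε⇒x≈y; x≈y⇒x∙y⁻¹≈ε)
  open import Relation.Binary.Reasoning.Setoid setoid

  pow≡^ : ∀ x n → pow x n ≡ x ^ n
  pow≡^ x zero = ≡.refl
  pow≡^ x (suc n) = ≡.cong (x *_) (pow≡^ x n)

  pow-+ : ∀ x m n → pow x (m ℕ.+ n) ≈ pow x m * pow x n
  pow-+ x m n = begin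
    pow x (m ℕ.+ n)      ≡⟨ pow≡^ x (m ℕ.+ n) ⟩
    x ^ (m ℕ.+ n)        ≈⟨ ^-homo-* x m n ⟩
    x ^ m * x ^ n        ≡⟨ ≡.cong₂ _*_ (pow≡^ x m) (pow≡^ x n) ⟨
    pow x m * pow x n    ∎

  pow-* : ∀ x y n → pow (x * y) n ≈ pow x n * pow y n
  pow-* x y n = begin
    pow (x * y) n        ≡⟨ pow≡^ (x * y) n ⟩
    (x * y) ^ n          ≈⟨ ^-distrib-* x y n ⟩
    x ^ n * y ^ n        ≡⟨ ≡.cong₂ _*_ (pow≡^ x n) (pow≡^ y n) ⟨
    pow x n * pow y n    ∎

  nonzero-pow : ∀ {x} n → 0 < n → ¬ (x ≈ 0#) → ¬ (pow x n ≈ 0#)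
  nonzero-pow {x} (suc zero) _ x≉0 xⁿ≈0 = x≉0 (trans (sym (*-identityʳ x)) xⁿ≈0)
  nonzero-pow {x} (suc (suc n)) _ x≉0 xⁿ≈0 =
    nonzero-pow (suc n) (s≤s z≤n) x≉0 (cancel (inverse x x≉0))
    where
    cancel : Σ Carrier (λ y → x * y ≈ 1#) → pow x (suc n) ≈ 0#
    cancel (y , xy≈1) = begin
      pow x (suc n)              ≈⟨ *-identityˡ _ ⟨
      1# * pow x (suc n)         ≈⟨ *-congʳ (trans (sym xy≈1) (*-comm x y)) ⟩
      (y * x) * pow x (suc n)    ≈⟨ *-assoc y x _ ⟩
      y * pow x (suc (suc n))    ≈⟨ *-congˡ xⁿ≈0 ⟩
      y * 0#                     ≈⟨ zeroʳ y ⟩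
      0#                         ∎

  module IntegerPowers (s s' : Carrier) (s-inv : s * s' ≈ 1#) where
    pz : ℤ → Carrier
    pz = powℤ s s'

    pz-⊖ : ∀ m n → pz (m ⊖ n) ≈ pow s m * pow s' n
    pz-⊖ m zero = sym (*-identityʳ _)
    pz-⊖ zero (suc n) = sym (*-identityˡ _)
    pz-⊖ (suc m) (suc n) = begin
      pz (suc m ⊖ suc n)                   ≡⟨ ≡.cong pz (ℤP.[1+m]⊖[1+n]≡m⊖n m n) ⟩
      pz (m ⊖ n)                           ≈⟨ pz-⊖ m n ⟩
      pow s m * pow s' n                   ≈⟨ *-identityˡ _ ⟨
      1# * (pow s m * pow s' n)            ≈⟨ *-congʳ s-inv ⟨
      (s * s') * (pow s m * pow s' n)      ≈⟨ interchange s s' _ _ ⟩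
      (s * pow s m) * (s' * pow s' n)      ∎

    pz-+ : ∀ a b → pz (a ℤ.+ b) ≈ pz a * pz b
    pz-+ (+ m) (+ n) = pow-+ s m n
    pz-+ (+ m) -[1+ n ] = pz-⊖ m (suc n)
    pz-+ -[1+ m ] (+ n) = trans (pz-⊖ n (suc m)) (*-comm _ _)
    pz-+ -[1+ m ] -[1+ n ] = begin
      pow s' (suc (suc (m ℕ.+ n)))      ≡⟨ ≡.cong (λ k → pow s' (suc k)) (ℕP.+-suc m n) ⟨
      pow s' (suc m ℕ.+ suc n)          ≈⟨ pow-+ s' (suc m) (suc n) ⟩
      pow s' (suc m) * pow s' (suc n)   ∎

    pz-· : ∀ m a → pz (+ m ℤ.* a) ≈ pow (pz a) m
    pz-· zero a = refl
    pz-· (suc m) a = begin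
      pz (+ suc m ℤ.* a)         ≡⟨ ≡.cong pz (ℤP.suc-* (+ m) a) ⟩
      pz (a ℤ.+ + m ℤ.* a)       ≈⟨ pz-+ a (+ m ℤ.* a) ⟩
      pz a * pz (+ m ℤ.* a)      ≈⟨ *-congˡ (pz-· m a) ⟩
      pz a * pow (pz a) m        ∎

  module Characters (s s' t t' : Carrier) (s-inv : s * s' ≈ 1#) (t-inv : t * t' ≈ 1#) where
    open IntegerPowers s s' s-inv renaming (pz-+ to s-+; pz-· to s-·)
    open IntegerPowers t t' t-inv renaming (pz-+ to t-+; pz-· to t-·)

    χ : Pt → Carrier
    χ p = character p s s' t t'

    χ-O : χ O ≈ 1#
    χ-O = *-identityˡ 1#

    χ-⊕ : ∀ p q → χ (p ⊕ q) ≈ χ p * χ q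
    χ-⊕ (a , b) (a' , b') = begin
      powℤ s s' (a ℤ.+ a') * powℤ t t' (b ℤ.+ b')
        ≈⟨ *-cong (s-+ a a') (t-+ b b') ⟩
      (powℤ s s' a * powℤ s s' a') * (powℤ t t' b * powℤ t t' b')
        ≈⟨ interchange _ _ _ _ ⟩
      (powℤ s s' a * powℤ t t' b) * (powℤ s s' a' * powℤ t t' b') ∎

    χ-· : ∀ m p → χ (m · p) ≈ pow (χ p) m
    χ-· m (a , b) = begin
      powℤ s s' (+ m ℤ.* a) * powℤ t t' (+ m ℤ.* b)   ≈⟨ *-cong (s-· m a) (t-· m b) ⟩
      pow (powℤ s s' a) m * pow (powℤ t t' b) m       ≈⟨ pow-* _ _ m ⟨
      pow (powℤ s s' a * powℤ t t' b) m               ∎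

    monomial-orbit : ∀ {N} lam (W : Vec ℕ N) (L : Vec Pt N) →
      monomial W (map (λ p → lam * χ p) L) ≈ pow lam (sumℕ W) * χ (wsum W L)
    monomial-orbit lam [] [] = sym (trans (*-identityˡ _) χ-O)
    monomial-orbit lam (w ∷ W) (p ∷ L) = begin
      pow (lam * χ p) w * monomial W (map (λ p → lam * χ p) L)
        ≈⟨ *-cong (pow-* lam (χ p) w) (monomial-orbit lam W L) ⟩
      (pow lam w * pow (χ p) w) * (pow lam (sumℕ W) * χ (wsum W L))
        ≈⟨ interchange _ _ _ _ ⟩
      (pow lam w * pow lam (sumℕ W)) * (pow (χ p) w * χ (wsum W L))
        ≈⟨ *-cong (sym (pow-+ lam w (sumℕ W))) (*-congʳ (sym (χ-· w p))) ⟩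
      pow lam (w ℕ.+ sumℕ W) * (χ (w · p) * χ (wsum W L))
        ≈⟨ *-congˡ (sym (χ-⊕ (w · p) (wsum W L))) ⟩
      pow lam (w ℕ.+ sumℕ W) * χ ((w · p) ⊕ wsum W L) ∎

  binomial : ∀ {N} → Vec ℕ N → Vec ℕ N → Poly N
  binomial W U = (1# , W) ∷ (- 1# , U) ∷ []

  eval-binomial : ∀ {N} (W U : Vec ℕ N) xs →
    evalPoly (binomial W U) xs ≈ monomial W xs - monomial U xs
  eval-binomial W U xs =
    +-cong (*-identityˡ _) (trans (+-identityʳ _) (-1*x≈-x (monomial U xs)))

  toric-relation : ∀ {N} (L : Vec Pt N) (W U : Vec ℕ N) →
    sumℕ W ≡ sumℕ U → wsum W L ≡ wsum U L →
    ∀ {u} → InCone L u → monomial W u ≈ monomial U u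
  toric-relation L W U same-degree same-sum {u} onCone =
    x∙y⁻¹≈ε⇒x≈y _ _ (trans (sym (eval-binomial W U u)) (onCone (binomial W U) vanishes-on-orbits))
    where
    vanishes-on-orbits : ∀ lam s s' t t' → s * s' ≈ 1# → t * t' ≈ 1# →
      evalPoly (binomial W U) (map (λ p → lam * character p s s' t t') L) ≈ 0#
    vanishes-on-orbits lam s s' t t' s-inv t-inv =
      trans (eval-binomial W U _) (x≈y⇒x∙y⁻¹≈ε (begin
        monomial W (map (λ p → lam * χ p) L)   ≈⟨ monomial-orbit lam W L ⟩
        pow lam (sumℕ W) * χ (wsum W L)        ≡⟨ ≡.cong₂ (λ d p → pow lam d * χ p) same-degree same-sum ⟩
        pow lam (sumℕ U) * χ (wsum U L)        ≈⟨ monomial-orbit lam U L ⟨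
        monomial U (map (λ p → lam * χ p) L)   ∎))
      where open Characters s s' t t' s-inv t-inv

  monomial-single : ∀ {N} (k : Fin N) S (xs : Vec Carrier N) →
    monomial (single k S) xs ≈ pow (lookup xs k) S
  monomial-single zero S (x ∷ xs) = trans (*-congˡ (monomial-zeros xs)) (*-identityʳ _)
    where
    monomial-zeros : ∀ {M} (ys : Vec Carrier M) → monomial (replicate M 0) ys ≈ 1#
    monomial-zeros [] = refl
    monomial-zeros (y ∷ ys) = trans (*-identityˡ _) (monomial-zeros ys)
  monomial-single (suc k) S (x ∷ xs) = trans (*-identityˡ _) (monomial-single k S xs)

  monomial-vanishes : ∀ {N} (W : Vec ℕ N) xs j → lookup xs j ≈ 0# → 0 < lookup W j → monomial W xs ≈ 0#
  monomial-vanishes (suc w ∷ W) (x ∷ xs) zero x≈0 _ = begin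
    (x * pow x w) * monomial W xs    ≈⟨ *-congʳ (*-congʳ x≈0) ⟩
    (0# * pow x w) * monomial W xs   ≈⟨ *-congʳ (zeroˡ _) ⟩
    0# * monomial W xs               ≈⟨ zeroˡ _ ⟩
    0#                               ∎
  monomial-vanishes (w ∷ W) (x ∷ xs) (suc j) xⱼ≈0 Wⱼ>0 =
    trans (*-congˡ (monomial-vanishes W xs j xⱼ≈0 Wⱼ>0)) (zeroʳ _)

  -- If L_k is a convex combination of the L_i giving L_j positive weight,
  -- then on the cone over X the vanishing of x_j forces that of x_k
  -- (by the relation x^W = x_k^{ΣW}).
  vanishing-propagates : ∀ {N} (L : Vec Pt N) (W : Vec ℕ N) k j →
    wsum W L ≡ sumℕ W · lookup L k → 0 < lookup W j →
    ∀ {u} → InCone L u → lookup u j ≈ 0# → ¬ ¬ (lookup u k ≈ 0#)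
  vanishing-propagates L W k j barycentre Wⱼ>0 {u} onCone uⱼ≈0 uₖ≉0 =
    nonzero-pow S (lookup-pos⇒sum-pos W j Wⱼ>0) uₖ≉0 (begin
      pow (lookup u k) S      ≈⟨ monomial-single k S u ⟨
      monomial (single k S) u ≈⟨ relation ⟨
      monomial W u            ≈⟨ monomial-vanishes W u j uⱼ≈0 Wⱼ>0 ⟩
      0#                      ∎)
    where
    S : ℕ
    S = sumℕ W
    relation : monomial W u ≈ monomial (single k S) u
    relation = toric-relation L W (single k S) (≡.sym (sum-single k S))
                 (≡.trans barycentre (≡.sym (wsum-single k S L))) onCone

  -- A line through [1:…:1] inside X contains the point v − v_j·1, whose j-th
  -- coordinate vanishes; by the propagation above its k-th does too, so v_k = v_j.
  line-coordinates-agree : ∀ {N} (L : Vec Pt N) (v : Vec Carrier N) →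
    (∀ a b → ¬ ((a ≈ 0#) × (b ≈ 0#)) → InCone L (tabulate (λ i → a + b * lookup v i))) →
    ∀ (W : Vec ℕ N) k j → wsum W L ≡ sumℕ W · lookup L k → 0 < lookup W j →
    ¬ ¬ (lookup v j ≈ lookup v k)
  line-coordinates-agree L v onX W k j barycentre Wⱼ>0 vⱼ≉vₖ =
    vanishing-propagates L W k j barycentre Wⱼ>0 onLine uⱼ≈0
      (λ uₖ≈0 → vⱼ≉vₖ (sym (x∙y⁻¹≈ε⇒x≈y _ _ (trans (+-comm _ _) (coordinate-of-u k uₖ≈0)))))
    where
    vⱼ : Carrier
    vⱼ = lookup v j
    u : Vec Carrier _
    u = tabulate (λ i → - vⱼ + 1# * lookup v i)
    onLine : InCone L u
    onLine = onX (- vⱼ) 1# (λ (_ , 1≈0) → 1≉0 1≈0)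
    coordinate-of-u : ∀ i → lookup u i ≈ 0# → - vⱼ + lookup v i ≈ 0#
    coordinate-of-u i uᵢ≈0 = begin
      - vⱼ + lookup v i          ≈⟨ +-congˡ (*-identityˡ _) ⟨
      - vⱼ + 1# * lookup v i     ≡⟨ VecP.lookup∘tabulate _ i ⟨
      lookup u i                 ≈⟨ uᵢ≈0 ⟩
      0#                         ∎
    uⱼ≈0 : lookup u j ≈ 0#
    uⱼ≈0 = begin
      lookup u j             ≡⟨ VecP.lookup∘tabulate _ j ⟩
      - vⱼ + 1# * vⱼ         ≈⟨ +-congˡ (*-identityˡ vⱼ) ⟩
      - vⱼ + vⱼ              ≈⟨ -‿inverseˡ vⱼ ⟩
      0#                     ∎

¬¬-all : ∀ {p n} (Q : Fin n → Set p) → (∀ i → ¬ ¬ Q i) → ¬ ¬ (∀ i → Q i)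
¬¬-all {n = zero} Q _ ¬all = ¬all (λ ())
¬¬-all {n = suc n} Q each ¬all =
  each zero λ Q₀ → ¬¬-all (λ i → Q (suc i)) (λ i → each (suc i))
    λ Qₛ → ¬all λ { zero → Q₀ ; (suc i) → Qₛ i }

theoremA6 : ∀ {c ℓ} (K : ACF0 c ℓ) {n : ℕ} (L : Vec Pt (suc n)) →
    BuildingBlock L → ¬ Toric.LineThroughIdentityOnX K L
theoremA6 K L (polygon , (q , interior , _) , _) (v , nonconstant , onX) =
  ¬¬-all (λ i → lookup v i ≈ lookup v k) agree (λ constant → nonconstant (lookup v k , constant))
  where
  open ACF0 K using (_≈_)
  listed : Σ (Fin _) λ k → lookup L k ≡ q
  listed = interior-is-listed polygon interior
  k : Fin _
  k = proj₁ listed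
  barycentre-is-Lₖ : ∀ W → wsum W L ≡ sumℕ W · q → wsum W L ≡ sumℕ W · lookup L k
  barycentre-is-Lₖ W = ≡.subst (λ p → wsum W L ≡ sumℕ W · p) (≡.sym (proj₂ listed))
  agree : ∀ i → ¬ ¬ (lookup v i ≈ lookup v k)
  agree i =
    let (W , Wᵢ>0 , barycentre) = interior-weights interior i
    in ToricSurface.line-coordinates-agree K L v onX W k i (barycentre-is-Lₖ W barycentre) Wᵢ>0
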